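{- For every integer $n \ge 1$ there exists a two-parameter Source-Sink Monotone (SSM) parametric network with source $s$, sink $t$ and $n$ internal nodes $N$ such that every one of the $2^n$ $s$--$t$ cuts is the unique minimum $s$--$t$ cut for some values of the parameters. That is, for every $S \subseteq N$ there are parameter values $(\lambda,\mu)$ at which $\{s\}\cup S$ is the unique minimum $s$--$t$ cut.
   Context: A two-parameter parametric network is a directed network with source $s$, sink $t$ and a set $N$ of internal nodes. Each arc $i\to j$ has capacity $u_{ij}(\lambda,\mu)=a_{ij}\lambda+b_{ij}\mu+c_{ij}$, where $(\lambda,\mu)$ are real parameters restricted to values at which all capacities are non-negative. The network is Source-Sink Monotone (SSM) if the following three conditions hold: - every arc $s\to j$ out of the source has capacity non-decreasing in each parameter, i.e. $a_{sj},b_{sj}\ge 0$; - every arc $i\to t$ into the sink has capacity non-increasing in each parameter, i.e. $a_{it},b_{it}\le 0$; - every other arc has constant capacity, i.e. $a_{ij}=b_{ij}=0$. An $s$--$t$ cut is a set of the form $\{s\}\cup S$ with $S\subseteq N$. Its capacity is the total capacity of the arcs leaving it. -}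

module Defs where

open import Data.Nat using (ℕ; zero; suc)
open import Data.Fin using (Fin; zero; suc)
open import Data.Bool using (Bool; true; false; if_then_else_)
open import Data.Vec using (lookup)
open import Data.Fin.Subset using (Subset)
open import Data.Rational using (ℚ; 0ℚ; _+_; _*_; _≤_; _<_)
open import Data.Product using (_×_; Σ; ∃; ∃-syntax)
open import Relation.Binary.PropositionalEquality using (_≡_)
open import Relation.Nullary using (¬_)

sumFin : (n : ℕ) → (Fin n → ℚ) → ℚ
sumFin zero    f = 0ℚ
sumFin (suc n) f = f zero + sumFin n (λ i → f (suc i))

linCap : ℚ → ℚ → ℚ → ℚ → ℚ → ℚ
linCap a b c l m = a * l + b * m + c

-- A missing arc is an arc of capacity identically 0.
--   s → j : srcA j · λ + srcB j · μ + srcC j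
--   i → t : snkA i · λ + snkB i · μ + snkC i
--   i → j : midA i j · λ + midB i j · μ + midC i j   (internal arcs)
--   s → t : stA · λ + stB · μ + stC
-- (Arcs into s or out of t never leave an s-t cut and are omitted.)
record ParamNet (n : ℕ) : Set where
  field
    srcA srcB srcC : Fin n → ℚ
    snkA snkB snkC : Fin n → ℚ
    midA midB midC : Fin n → Fin n → ℚ
    stA stB stC    : ℚ

open ParamNet public

-- Source-Sink Monotone.  The s → t arc is both out of the source and into
-- the sink, so it is forced to have constant capacity.
SSM : {n : ℕ} → ParamNet n → Set
SSM {n} N =
  ((j : Fin n) → (0ℚ ≤ srcA N j) × (0ℚ ≤ srcB N j)) ×
  ((i : Fin n) → (snkA N i ≤ 0ℚ) × (snkB N i ≤ 0ℚ)) ×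
  ((i j : Fin n) → (midA N i j ≡ 0ℚ) × (midB N i j ≡ 0ℚ)) ×
  (0ℚ ≤ stA N) × (stA N ≤ 0ℚ) × (0ℚ ≤ stB N) × (stB N ≤ 0ℚ)

Admissible : {n : ℕ} → ParamNet n → ℚ → ℚ → Set
Admissible {n} N l m =
  ((j : Fin n) → 0ℚ ≤ linCap (srcA N j) (srcB N j) (srcC N j) l m) ×
  ((i : Fin n) → 0ℚ ≤ linCap (snkA N i) (snkB N i) (snkC N i) l m) ×
  ((i j : Fin n) → 0ℚ ≤ linCap (midA N i j) (midB N i j) (midC N i j) l m) ×
  (0ℚ ≤ linCap (stA N) (stB N) (stC N) l m)

cutCap : {n : ℕ} → ParamNet n → Subset n → ℚ → ℚ → ℚ
cutCap {n} N S l m =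
  sumFin n (λ j → if lookup S j then 0ℚ
                  else linCap (srcA N j) (srcB N j) (srcC N j) l m)
  + sumFin n (λ i → if lookup S i
                    then linCap (snkA N i) (snkB N i) (snkC N i) l m
                    else 0ℚ)
  + sumFin n (λ i → sumFin n (λ j →
        if lookup S i
        then (if lookup S j then 0ℚ
              else linCap (midA N i j) (midB N i j) (midC N i j) l m)
        else 0ℚ))
  + linCap (stA N) (stB N) (stC N) l m

UniqueMinCut : {n : ℕ} → ParamNet n → Subset n → ℚ → ℚ → Set
UniqueMinCut {n} N S l m =
  (T : Subset n) → ¬ (T ≡ S) → cutCap N S l m < cutCap N T l m

{-# OPTIONS --safe #-}
-- Arrange the internal nodes in layers 0, …, n − 1.  Layer k has a source arc of capacity
-- v k · (λ, μ) with v k in the positive quadrant, a constant sink arc r k, and constant arcs of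
-- capacity v s · e k to the lower layers s < k.  These arcs make a cut that contains layer k,
-- evaluated at p − e k, cost exactly r k more than the cut of the lower layers at p.  So if q S is
-- a base point moved by − e k for every k ∈ S, cuts can be compared from the top layer down, and
-- {s} ∪ S is the unique minimum cut at q S as soon as, for the points q of the lower layers,
--   v k · q < r k   and   r k + Σ_{s<k} v s · e k < v k · (q − e k).
-- Such r k exist when v s · e k ≥ 0 ≥ v k · e s for s < k and − v k · e k dominates the sum of
-- these terms; for v k = 17^k (1, 2k + 1) and e k = 2 · 17^k (2k, −1) this is a geometric estimate.
module Submission where

open import Defs
open import Data.Nat using (ℕ; zero; suc; _≤_; _<_)
import Data.Nat as ℕ
import Data.Nat.Properties as ℕₚ
open import Data.Fin using (Fin; zero; suc)
open import Data.Fin.Subset using (Subset; ∁)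
open import Data.Bool using (true; false; if_then_else_)
import Data.Bool.Properties as Bool
open import Data.Vec using ([]; _∷_; lookup)
open import Data.Vec.Properties using (≡-dec)
open import Data.Product using (_×_; Σ; ∃-syntax; _,_; proj₁; proj₂)
open import Function using (_∘_)
open import Relation.Nullary using (yes; no; contradiction)
open import Relation.Binary.PropositionalEquality
  using (_≡_; refl; sym; trans; cong; cong₂; subst; module ≡-Reasoning)
open import Data.Rational using (ℚ; 0ℚ; 1ℚ; _+_; _*_; -_; _-_; nonNegative; positive)
import Data.Rational as ℚ
open import Data.Rational.Properties
  using ( ≤-refl; ≤-trans; <⇒≤; <-≤-trans; positive⁻¹; nonNegative⁻¹
        ; +-identityˡ; +-identityʳ; +-inverseʳ; +-mono-≤; +-monoˡ-≤; +-monoʳ-≤; +-mono-<-≤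
        ; +-monoʳ-<; +-monoˡ-<; neg-antimono-≤; *-monoˡ-≤-nonNeg
        ; nonNeg*nonNeg⇒nonNeg; pos*pos⇒pos; module ≤-Reasoning )
open import Data.Rational.Solver using (module +-*-Solver)
open +-*-Solver using (solve; _:+_; _:-_; _:*_; :-_; _:=_; con)

0≤1 : 0ℚ ℚ.≤ 1ℚ
0≤1 = <⇒≤ (positive⁻¹ 1ℚ)

0≤+ : ∀ {p q} → 0ℚ ℚ.≤ p → 0ℚ ℚ.≤ q → 0ℚ ℚ.≤ p + q
0≤+ = +-mono-≤

0≤* : ∀ {p q} → 0ℚ ℚ.≤ p → 0ℚ ℚ.≤ q → 0ℚ ℚ.≤ p * q
0≤* {p} {q} 0≤p 0≤q = nonNegative⁻¹ (p * q)
  {{nonNeg*nonNeg⇒nonNeg p {{nonNegative 0≤p}} q {{nonNegative 0≤q}}}}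

p≤p+q : ∀ p {q} → 0ℚ ℚ.≤ q → p ℚ.≤ p + q
p≤p+q p {q} 0≤q = subst (ℚ._≤ p + q) (+-identityʳ p) (+-monoʳ-≤ p 0≤q)

p<p+q : ∀ p {q} → 0ℚ ℚ.< q → p ℚ.< p + q
p<p+q p {q} 0<q = subst (ℚ._< p + q) (+-identityʳ p) (+-monoʳ-< p 0<q)

≤⇒0≤- : ∀ {p q} → p ℚ.≤ q → 0ℚ ℚ.≤ q - p
≤⇒0≤- {p} {q} p≤q = subst (ℚ._≤ q - p) (+-inverseʳ p) (+-monoˡ-≤ (- p) p≤q)

ι : ℕ → ℚ
ι zero    = 0ℚ
ι (suc n) = 1ℚ + ι n

ι-+ : ∀ m n → ι (m ℕ.+ n) ≡ ι m + ι n
ι-+ zero    n = sym (+-identityˡ (ι n))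
ι-+ (suc m) n = trans (cong (1ℚ +_) (ι-+ m n)) (solve 3 (λ a b c → a :+ (b :+ c) := a :+ b :+ c) refl 1ℚ (ι m) (ι n))

0≤ι : ∀ n → 0ℚ ℚ.≤ ι n
0≤ι zero    = ≤-refl
0≤ι (suc n) = 0≤+ 0≤1 (0≤ι n)

<⇒1≤ι-ι : ∀ {s k} → s < k → 1ℚ ℚ.≤ ι k - ι s
<⇒1≤ι-ι {s} s<k with ℕₚ.m≤n⇒∃[o]m+o≡n s<k
... | d , refl = begin
  1ℚ                      ≤⟨ p≤p+q 1ℚ (0≤ι d) ⟩
  1ℚ + ι d                ≡⟨ solve 2 (λ x y → con 1ℚ :+ y := con 1ℚ :+ (x :+ y) :- x) refl (ι s) (ι d) ⟩
  1ℚ + (ι s + ι d) - ι s  ≡⟨ cong (λ t → 1ℚ + t - ι s) (sym (ι-+ s d)) ⟩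
  ι (suc s ℕ.+ d) - ι s   ∎
  where open ≤-Reasoning

Σ< : ℕ → (ℕ → ℚ) → ℚ
Σ< zero    g = 0ℚ
Σ< (suc k) g = g k + Σ< k g

Σ∈ : (k : ℕ) → Subset k → (ℕ → ℚ) → ℚ
Σ∈ zero    []      g = 0ℚ
Σ∈ (suc k) (b ∷ S) g = (if b then g k else 0ℚ) + Σ∈ k S g

Σ<-cong : ∀ k {f g} → (∀ s → f s ≡ g s) → Σ< k f ≡ Σ< k g
Σ<-cong zero    f≡g = refl
Σ<-cong (suc k) f≡g = cong₂ _+_ (f≡g k) (Σ<-cong k f≡g)

Σ<-+ : ∀ k f g → Σ< k f + Σ< k g ≡ Σ< k (λ s → f s + g s)
Σ<-+ zero    f g = refl
Σ<-+ (suc k) f g = trans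
  (solve 4 (λ a b c d → (a :+ b) :+ (c :+ d) := (a :+ c) :+ (b :+ d)) refl (f k) (Σ< k f) (g k) (Σ< k g))
  (cong (f k + g k +_) (Σ<-+ k f g))

Σ<-sub : ∀ k f g → Σ< k f - Σ< k g ≡ Σ< k (λ s → f s - g s)
Σ<-sub zero    f g = refl
Σ<-sub (suc k) f g = trans
  (solve 4 (λ a b c d → (a :+ b) :- (c :+ d) := (a :- c) :+ (b :- d)) refl (f k) (Σ< k f) (g k) (Σ< k g))
  (cong (f k - g k +_) (Σ<-sub k f g))

Σ<-*ˡ : ∀ k c f → c * Σ< k f ≡ Σ< k (λ s → c * f s)
Σ<-*ˡ zero    c f = solve 1 (λ c → c :* con 0ℚ := con 0ℚ) refl c
Σ<-*ˡ (suc k) c f = trans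
  (solve 3 (λ c a b → c :* (a :+ b) := c :* a :+ c :* b) refl c (f k) (Σ< k f))
  (cong (c * f k +_) (Σ<-*ˡ k c f))

∀<suc⇒∀< : ∀ {k} {P : ℕ → Set} → (∀ {s} → s < suc k → P s) → ∀ {s} → s < k → P s
∀<suc⇒∀< H s<k = H (ℕₚ.m<n⇒m<1+n s<k)

Σ<-nonNeg : ∀ {k g} → (∀ {s} → s < k → 0ℚ ℚ.≤ g s) → 0ℚ ℚ.≤ Σ< k g
Σ<-nonNeg {zero}  H = ≤-refl
Σ<-nonNeg {suc k} H = 0≤+ (H (ℕₚ.n<1+n k)) (Σ<-nonNeg (∀<suc⇒∀< H))

Σ<-nonPos : ∀ {k g} → (∀ {s} → s < k → g s ℚ.≤ 0ℚ) → Σ< k g ℚ.≤ 0ℚ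
Σ<-nonPos {zero}  H = ≤-refl
Σ<-nonPos {suc k} H = +-mono-≤ (H (ℕₚ.n<1+n k)) (Σ<-nonPos (∀<suc⇒∀< H))

Σ∈-nonNeg : ∀ {k g} → (∀ {s} → s < k → 0ℚ ℚ.≤ g s) → ∀ S → 0ℚ ℚ.≤ Σ∈ k S g
Σ∈-nonNeg {zero}  H []          = ≤-refl
Σ∈-nonNeg {suc k} H (true  ∷ S) = 0≤+ (H (ℕₚ.n<1+n k)) (Σ∈-nonNeg (∀<suc⇒∀< H) S)
Σ∈-nonNeg {suc k} H (false ∷ S) = 0≤+ ≤-refl (Σ∈-nonNeg (∀<suc⇒∀< H) S)

Σ∈-nonPos : ∀ {k g} → (∀ {s} → s < k → g s ℚ.≤ 0ℚ) → ∀ S → Σ∈ k S g ℚ.≤ 0ℚ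
Σ∈-nonPos {zero}  H []          = ≤-refl
Σ∈-nonPos {suc k} H (true  ∷ S) = +-mono-≤ (H (ℕₚ.n<1+n k)) (Σ∈-nonPos (∀<suc⇒∀< H) S)
Σ∈-nonPos {suc k} H (false ∷ S) = +-mono-≤ ≤-refl (Σ∈-nonPos (∀<suc⇒∀< H) S)

Σ∈≤Σ< : ∀ {k g} → (∀ {s} → s < k → 0ℚ ℚ.≤ g s) → ∀ S → Σ∈ k S g ℚ.≤ Σ< k g
Σ∈≤Σ< {zero}  H []          = ≤-refl
Σ∈≤Σ< {suc k} {g} H (true  ∷ S) = +-monoʳ-≤ (g k) (Σ∈≤Σ< (∀<suc⇒∀< H) S)
Σ∈≤Σ< {suc k} {g} H (false ∷ S) = +-mono-≤ (H (ℕₚ.n<1+n k)) (Σ∈≤Σ< (∀<suc⇒∀< H) S)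

Σ<≤Σ∈ : ∀ {k g} → (∀ {s} → s < k → g s ℚ.≤ 0ℚ) → ∀ S → Σ< k g ℚ.≤ Σ∈ k S g
Σ<≤Σ∈ {zero}  H []          = ≤-refl
Σ<≤Σ∈ {suc k} {g} H (true  ∷ S) = +-monoʳ-≤ (g k) (Σ<≤Σ∈ (∀<suc⇒∀< H) S)
Σ<≤Σ∈ {suc k} {g} H (false ∷ S) = +-mono-≤ (H (ℕₚ.n<1+n k)) (Σ<≤Σ∈ (∀<suc⇒∀< H) S)

ℚ² : Set
ℚ² = ℚ × ℚ

infixl 7 _·_
infixl 6 _⊖_

_·_ : ℚ² → ℚ² → ℚ
u · p = proj₁ u * proj₁ p + proj₂ u * proj₂ p

_⊖_ : ℚ² → ℚ² → ℚ²
p ⊖ q = proj₁ p - proj₁ q , proj₂ p - proj₂ q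

·-⊖ : ∀ u p q → u · (p ⊖ q) ≡ u · p - u · q
·-⊖ (a , b) (x , y) (x′ , y′) =
  solve 6 (λ a b x y x′ y′ → a :* (x :- x′) :+ b :* (y :- y′) := (a :* x :+ b :* y) :- (a :* x′ :+ b :* y′))
    refl a b x y x′ y′

·-⊖-cancel : ∀ u p q → u · (p ⊖ q) + u · q ≡ u · p
·-⊖-cancel u p q = trans (cong (_+ u · q) (·-⊖ u p q)) (solve 2 (λ x y → x :- y :+ y := x) refl (u · p) (u · q))

linCap-const : ∀ c l m → linCap 0ℚ 0ℚ c l m ≡ c
linCap-const c l m = solve 3 (λ c l m → con 0ℚ :* l :+ con 0ℚ :* m :+ c := c) refl c l m

cutAt : {n : ℕ} → ParamNet n → Subset n → ℚ² → ℚ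
cutAt N S p = cutCap N S (proj₁ p) (proj₂ p)

UniqueMinCut⇒≤ : ∀ {n} {N : ParamNet n} {S l m} → UniqueMinCut N S l m →
                 ∀ T → cutCap N S l m ℚ.≤ cutCap N T l m
UniqueMinCut⇒≤ {S = S} unique T with ≡-dec Bool._≟_ T S
... | yes refl = ≤-refl
... | no  T≢S  = <⇒≤ (unique T T≢S)

sumFin-cong : ∀ n {f g : Fin n → ℚ} → (∀ i → f i ≡ g i) → sumFin n f ≡ sumFin n g
sumFin-cong zero    f≡g = refl
sumFin-cong (suc n) f≡g = cong₂ _+_ (f≡g zero) (sumFin-cong n (f≡g ∘ suc))

sumFin-zero : ∀ n → sumFin n (λ _ → 0ℚ) ≡ 0ℚ
sumFin-zero zero    = refl
sumFin-zero (suc n) = trans (+-identityˡ _) (sumFin-zero n)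

module Layered (v e : ℕ → ℚ²) (r : ℕ → ℚ) where

  -- Node zero of Fin (suc k) is layer k; the remaining nodes form the network on layers below k.
  level : (n : ℕ) → Fin n → ℕ
  level (suc k) zero    = k
  level (suc k) (suc j) = level k j

  level< : ∀ n j → level n j < n
  level< (suc k) zero    = ℕₚ.n<1+n k
  level< (suc k) (suc j) = ℕₚ.m<n⇒m<1+n (level< k j)

  link : (n : ℕ) → Fin n → Fin n → ℚ
  link (suc k) zero    zero    = 0ℚ
  link (suc k) zero    (suc j) = v (level k j) · e k
  link (suc k) (suc i) zero    = 0ℚ
  link (suc k) (suc i) (suc j) = link k i j

  net : (n : ℕ) → ParamNet n
  net n = record
    { srcA = proj₁ ∘ v ∘ level n ; srcB = proj₂ ∘ v ∘ level n ; srcC = λ _ → 0ℚ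
    ; snkA = λ _ → 0ℚ ; snkB = λ _ → 0ℚ ; snkC = r ∘ level n
    ; midA = λ _ _ → 0ℚ ; midB = λ _ _ → 0ℚ ; midC = link n
    ; stA = 0ℚ ; stB = 0ℚ ; stC = 0ℚ
    }

  net-SSM : ∀ n → (∀ s → 0ℚ ℚ.≤ proj₁ (v s) × 0ℚ ℚ.≤ proj₂ (v s)) → SSM (net n)
  net-SSM n 0≤v = 0≤v ∘ level n , (λ _ → ≤-refl , ≤-refl) , (λ _ _ → refl , refl) , ≤-refl , ≤-refl , ≤-refl , ≤-refl

  point : ℚ² → (k : ℕ) → Subset k → ℚ²
  point o zero    []          = o
  point o (suc k) (false ∷ S) = point o k S
  point o (suc k) (true  ∷ S) = point o k S ⊖ e k

  point-additive : (f : ℚ² → ℚ) → (∀ p q → f (p ⊖ q) ≡ f p - f q) →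
                   ∀ o k S → f (point o k S) ≡ f o - Σ∈ k S (f ∘ e)
  point-additive f f-⊖ o zero    []          = sym (+-identityʳ (f o))
  point-additive f f-⊖ o (suc k) (false ∷ S) = trans (point-additive f f-⊖ o k S)
    (solve 2 (λ x y → x :- y := x :- (con 0ℚ :+ y)) refl (f o) (Σ∈ k S (f ∘ e)))
  point-additive f f-⊖ o (suc k) (true  ∷ S) = begin
    f (point o k S ⊖ e k)                   ≡⟨ f-⊖ (point o k S) (e k) ⟩
    f (point o k S) - f (e k)               ≡⟨ cong (_- f (e k)) (point-additive f f-⊖ o k S) ⟩
    f o - Σ∈ k S (f ∘ e) - f (e k)          ≡⟨ solve 3 (λ x y z → x :- y :- z := x :- (z :+ y)) refl (f o) (Σ∈ k S (f ∘ e)) (f (e k)) ⟩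
    f o - Σ∈ (suc k) (true ∷ S) (f ∘ e)     ∎
    where open ≡-Reasoning

  outflow : (k : ℕ) → Subset k → ℚ² → ℚ
  outflow k T u = Σ∈ k (∁ T) (λ s → v s · u)

  sumFin-level : ∀ k T (g : ℕ → ℚ) → sumFin k (λ j → if lookup T j then 0ℚ else g (level k j)) ≡ Σ∈ k (∁ T) g
  sumFin-level zero    []          g = refl
  sumFin-level (suc k) (true  ∷ T) g = cong (0ℚ +_) (sumFin-level k T g)
  sumFin-level (suc k) (false ∷ T) g = cong (g k +_) (sumFin-level k T g)

  srcCut snkCut midCut : (k : ℕ) → Subset k → ℚ² → ℚ
  srcCut k S p = sumFin k (λ j → if lookup S j then 0ℚ else v (level k j) · p + 0ℚ)
  snkCut k S p = sumFin k (λ i → if lookup S i then linCap 0ℚ 0ℚ (r (level k i)) (proj₁ p) (proj₂ p) else 0ℚ)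
  midCut k S p = sumFin k (λ i → sumFin k (λ j →
    if lookup S i then (if lookup S j then 0ℚ else linCap 0ℚ 0ℚ (link k i j) (proj₁ p) (proj₂ p)) else 0ℚ))

  stCut : ℚ² → ℚ
  stCut p = linCap 0ℚ 0ℚ 0ℚ (proj₁ p) (proj₂ p)

  midCut-lower-rows : ∀ k b T p →
    sumFin k (λ i → (if lookup T i then (if b then 0ℚ else stCut p) else 0ℚ) +
                    sumFin k (λ j → if lookup T i then (if lookup T j then 0ℚ
                                     else linCap 0ℚ 0ℚ (link k i j) (proj₁ p) (proj₂ p)) else 0ℚ))
    ≡ midCut k T p
  midCut-lower-rows k b T p = sumFin-cong k (λ i → trans (cong (_+ _) (zero-column (lookup T i) b)) (+-identityˡ _))
    where
    zero-column : ∀ c b → (if c then (if b then 0ℚ else stCut p) else 0ℚ) ≡ 0ℚ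
    zero-column true  true  = refl
    zero-column true  false = linCap-const 0ℚ (proj₁ p) (proj₂ p)
    zero-column false b     = refl

  midCut-false : ∀ k T p → midCut (suc k) (false ∷ T) p ≡ midCut k T p
  midCut-false k T p = trans (cong₂ _+_ (trans (+-identityˡ _) (sumFin-zero k)) (midCut-lower-rows k false T p)) (+-identityˡ _)

  midCut-true : ∀ k T p → midCut (suc k) (true ∷ T) p ≡ outflow k T (e k) + midCut k T p
  midCut-true k T p = cong₂ _+_ top-row (midCut-lower-rows k true T p)
    where
    top-row : 0ℚ + sumFin k (λ j → if lookup T j then 0ℚ else linCap 0ℚ 0ℚ (v (level k j) · e k) (proj₁ p) (proj₂ p))
              ≡ outflow k T (e k)
    top-row = trans (+-identityˡ _) (trans
      (sumFin-cong k (λ j → cong (if lookup T j then 0ℚ else_) (linCap-const _ (proj₁ p) (proj₂ p))))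
      (sumFin-level k T (λ s → v s · e k)))

  cut-false : ∀ k T p → cutAt (net (suc k)) (false ∷ T) p ≡ v k · p + cutAt (net k) T p
  cut-false k T p = begin
    (v k · p + 0ℚ + srcCut k T p) + (0ℚ + snkCut k T p) + midCut (suc k) (false ∷ T) p + stCut p
      ≡⟨ cong (λ x → (v k · p + 0ℚ + srcCut k T p) + (0ℚ + snkCut k T p) + x + stCut p) (midCut-false k T p) ⟩
    (v k · p + 0ℚ + srcCut k T p) + (0ℚ + snkCut k T p) + midCut k T p + stCut p
      ≡⟨ solve 5 (λ a x y z c → (a :+ con 0ℚ :+ x) :+ (con 0ℚ :+ y) :+ z :+ c := a :+ (x :+ y :+ z :+ c))
           refl (v k · p) (srcCut k T p) (snkCut k T p) (midCut k T p) (stCut p) ⟩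
    v k · p + cutAt (net k) T p ∎
    where open ≡-Reasoning

  cut-true : ∀ k T p → cutAt (net (suc k)) (true ∷ T) p ≡ r k + outflow k T (e k) + cutAt (net k) T p
  cut-true k T p = begin
    (0ℚ + srcCut k T p) + (linCap 0ℚ 0ℚ (r k) (proj₁ p) (proj₂ p) + snkCut k T p) + midCut (suc k) (true ∷ T) p + stCut p
      ≡⟨ cong₂ (λ x y → (0ℚ + srcCut k T p) + (x + snkCut k T p) + y + stCut p)
           (linCap-const (r k) (proj₁ p) (proj₂ p)) (midCut-true k T p) ⟩
    (0ℚ + srcCut k T p) + (r k + snkCut k T p) + (outflow k T (e k) + midCut k T p) + stCut p
      ≡⟨ solve 6 (λ a o x y z c → (con 0ℚ :+ x) :+ (a :+ y) :+ (o :+ z) :+ c := a :+ o :+ (x :+ y :+ z :+ c))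
           refl (r k) (outflow k T (e k)) (srcCut k T p) (snkCut k T p) (midCut k T p) (stCut p) ⟩
    r k + outflow k T (e k) + cutAt (net k) T p ∎
    where open ≡-Reasoning

  cut-empty : ∀ p → cutAt (net zero) [] p ≡ 0ℚ
  cut-empty p = trans (+-identityˡ (stCut p)) (linCap-const 0ℚ (proj₁ p) (proj₂ p))

  cut-⊖ : ∀ k T p u → cutAt (net k) T (p ⊖ u) + outflow k T u ≡ cutAt (net k) T p
  cut-⊖ zero    []          p u = trans (+-identityʳ _) (trans (cut-empty (p ⊖ u)) (sym (cut-empty p)))
  cut-⊖ (suc k) (false ∷ T) p u = begin
    cutAt (net (suc k)) (false ∷ T) (p ⊖ u) + (v k · u + outflow k T u)
      ≡⟨ cong (_+ _) (cut-false k T (p ⊖ u)) ⟩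
    v k · (p ⊖ u) + cutAt (net k) T (p ⊖ u) + (v k · u + outflow k T u)
      ≡⟨ solve 4 (λ a c b d → a :+ c :+ (b :+ d) := (a :+ b) :+ (c :+ d)) refl
           (v k · (p ⊖ u)) (cutAt (net k) T (p ⊖ u)) (v k · u) (outflow k T u) ⟩
    (v k · (p ⊖ u) + v k · u) + (cutAt (net k) T (p ⊖ u) + outflow k T u)
      ≡⟨ cong₂ _+_ (·-⊖-cancel (v k) p u) (cut-⊖ k T p u) ⟩
    v k · p + cutAt (net k) T p
      ≡⟨ sym (cut-false k T p) ⟩
    cutAt (net (suc k)) (false ∷ T) p ∎
    where open ≡-Reasoning
  cut-⊖ (suc k) (true  ∷ T) p u = begin
    cutAt (net (suc k)) (true ∷ T) (p ⊖ u) + (0ℚ + outflow k T u)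
      ≡⟨ cong (_+ _) (cut-true k T (p ⊖ u)) ⟩
    r k + outflow k T (e k) + cutAt (net k) T (p ⊖ u) + (0ℚ + outflow k T u)
      ≡⟨ solve 3 (λ a c o → a :+ c :+ (con 0ℚ :+ o) := a :+ (c :+ o)) refl
           (r k + outflow k T (e k)) (cutAt (net k) T (p ⊖ u)) (outflow k T u) ⟩
    r k + outflow k T (e k) + (cutAt (net k) T (p ⊖ u) + outflow k T u)
      ≡⟨ cong (r k + outflow k T (e k) +_) (cut-⊖ k T p u) ⟩
    r k + outflow k T (e k) + cutAt (net k) T p
      ≡⟨ sym (cut-true k T p) ⟩
    cutAt (net (suc k)) (true ∷ T) p ∎
    where open ≡-Reasoning

  -- The arcs from layer k to the layers outside T cost exactly what the shift by − e k saves there.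
  cut-true-⊖ : ∀ k T q → cutAt (net (suc k)) (true ∷ T) (q ⊖ e k) ≡ r k + cutAt (net k) T q
  cut-true-⊖ k T q = begin
    cutAt (net (suc k)) (true ∷ T) (q ⊖ e k)
      ≡⟨ cut-true k T (q ⊖ e k) ⟩
    r k + outflow k T (e k) + cutAt (net k) T (q ⊖ e k)
      ≡⟨ solve 3 (λ a o c → a :+ o :+ c := a :+ (c :+ o)) refl (r k) (outflow k T (e k)) (cutAt (net k) T (q ⊖ e k)) ⟩
    r k + (cutAt (net k) T (q ⊖ e k) + outflow k T (e k))
      ≡⟨ cong (r k +_) (cut-⊖ k T q (e k)) ⟩
    r k + cutAt (net k) T q ∎
    where open ≡-Reasoning

  module _ (0≤v·e : ∀ {s k} → s < k → 0ℚ ℚ.≤ v s · e k) where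

    0≤link : ∀ n i j → 0ℚ ℚ.≤ link n i j
    0≤link (suc k) zero    zero    = ≤-refl
    0≤link (suc k) zero    (suc j) = 0≤v·e (level< k j)
    0≤link (suc k) (suc i) zero    = ≤-refl
    0≤link (suc k) (suc i) (suc j) = 0≤link k i j

    0≤outflow : ∀ k T → 0ℚ ℚ.≤ outflow k T (e k)
    0≤outflow k T = Σ∈-nonNeg 0≤v·e (∁ T)

    outflow≤Σ< : ∀ k T → outflow k T (e k) ℚ.≤ Σ< k (λ s → v s · e k)
    outflow≤Σ< k T = Σ∈≤Σ< 0≤v·e (∁ T)

    net-admissible : ∀ n p → (∀ s → 0ℚ ℚ.≤ v s · p) → (∀ s → 0ℚ ℚ.≤ r s) →
                     Admissible (net n) (proj₁ p) (proj₂ p)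
    net-admissible n p 0≤v·p 0≤r =
      (λ j → subst (0ℚ ℚ.≤_) (sym (+-identityʳ _)) (0≤v·p (level n j))) ,
      (λ i → subst (0ℚ ℚ.≤_) (sym (linCap-const _ (proj₁ p) (proj₂ p))) (0≤r (level n i))) ,
      (λ i j → subst (0ℚ ℚ.≤_) (sym (linCap-const _ (proj₁ p) (proj₂ p))) (0≤link n i j)) ,
      subst (0ℚ ℚ.≤_) (sym (linCap-const _ (proj₁ p) (proj₂ p))) ≤-refl

    module _ (o : ℚ²)
             (v·point<r : ∀ k S → v k · point o k S ℚ.< r k)
             (r+W<v·point⊖e : ∀ k S → r k + Σ< k (λ s → v s · e k) ℚ.< v k · (point o k S ⊖ e k))
             where

      point-unique : ∀ k S → UniqueMinCut (net k) S (proj₁ (point o k S)) (proj₂ (point o k S))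
      point-unique zero [] [] T≢S = contradiction refl T≢S
      point-unique (suc k) (false ∷ S) (false ∷ T) T≢S = begin-strict
        cutAt (net (suc k)) (false ∷ S) q  ≡⟨ cut-false k S q ⟩
        v k · q + cutAt (net k) S q        <⟨ +-monoʳ-< (v k · q) (point-unique k S T (T≢S ∘ cong (false ∷_))) ⟩
        v k · q + cutAt (net k) T q        ≡⟨ sym (cut-false k T q) ⟩
        cutAt (net (suc k)) (false ∷ T) q  ∎
        where open ≤-Reasoning; q = point o k S
      point-unique (suc k) (false ∷ S) (true ∷ T) _ = begin-strict
        cutAt (net (suc k)) (false ∷ S) q          ≡⟨ cut-false k S q ⟩
        v k · q + cutAt (net k) S q                <⟨ +-mono-<-≤ (v·point<r k S) (UniqueMinCut⇒≤ {N = net k} (point-unique k S) T) ⟩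
        r k + cutAt (net k) T q                    ≤⟨ +-monoˡ-≤ (cutAt (net k) T q) (p≤p+q (r k) (0≤outflow k T)) ⟩
        r k + outflow k T (e k) + cutAt (net k) T q ≡⟨ sym (cut-true k T q) ⟩
        cutAt (net (suc k)) (true ∷ T) q           ∎
        where open ≤-Reasoning; q = point o k S
      point-unique (suc k) (true ∷ S) (true ∷ T) T≢S = begin-strict
        cutAt (net (suc k)) (true ∷ S) (q ⊖ e k)  ≡⟨ cut-true-⊖ k S q ⟩
        r k + cutAt (net k) S q                   <⟨ +-monoʳ-< (r k) (point-unique k S T (T≢S ∘ cong (true ∷_))) ⟩
        r k + cutAt (net k) T q                   ≡⟨ sym (cut-true-⊖ k T q) ⟩
        cutAt (net (suc k)) (true ∷ T) (q ⊖ e k)  ∎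
        where open ≤-Reasoning; q = point o k S
      point-unique (suc k) (true ∷ S) (false ∷ T) _ = begin-strict
        cutAt (net (suc k)) (true ∷ S) (q ⊖ e k)            ≡⟨ cut-true-⊖ k S q ⟩
        r k + cutAt (net k) S q                             ≤⟨ +-monoʳ-≤ (r k) (UniqueMinCut⇒≤ {N = net k} (point-unique k S) T) ⟩
        r k + cutAt (net k) T q                             ≡⟨ cong (r k +_) (sym (cut-⊖ k T q (e k))) ⟩
        r k + (cutAt (net k) T q′ + outflow k T (e k))      ≤⟨ +-monoʳ-≤ (r k) (+-monoʳ-≤ (cutAt (net k) T q′) (outflow≤Σ< k T)) ⟩
        r k + (cutAt (net k) T q′ + W)                      ≡⟨ solve 3 (λ a c w → a :+ (c :+ w) := a :+ w :+ c) refl (r k) (cutAt (net k) T q′) W ⟩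
        r k + W + cutAt (net k) T q′                        <⟨ +-monoˡ-< (cutAt (net k) T q′) (r+W<v·point⊖e k S) ⟩
        v k · q′ + cutAt (net k) T q′                       ≡⟨ sym (cut-false k T q′) ⟩
        cutAt (net (suc k)) (false ∷ T) q′                  ∎
        where
        open ≤-Reasoning
        q = point o k S
        q′ = q ⊖ e k
        W = Σ< k (λ s → v s · e k)

-- The base 17 = 1 + 8 + 8 is what the induction step of P≤w×8Q+1≤w needs.
w : ℕ → ℚ
w zero    = 1ℚ
w (suc k) = ι 17 * w k

-- e k is orthogonal to (1, 2k), which separates the slopes 2s + 1 of the v s with s < k from those
-- with s ≥ k; this fixes the signs of the v s · e k (see v·e).
v e : ℕ → ℚ²
v k = w k , (ι 2 * ι k + 1ℚ) * w k
e k = ι 4 * ι k * w k , - (ι 2 * w k)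

P Q : ℕ → ℚ
P k = Σ< k w
Q k = Σ< k (λ s → (ι k - ι s) * w s)

1≤w : ∀ k → 1ℚ ℚ.≤ w k
1≤w zero    = ≤-refl
1≤w (suc k) = ≤-trans (1≤w k) (subst (w k ℚ.≤_)
  (solve 1 (λ x → x :+ con (ι 16) :* x := con (ι 17) :* x) refl (w k))
  (p≤p+q (w k) (0≤* (0≤ι 16) (≤-trans 0≤1 (1≤w k)))))

0≤w : ∀ k → 0ℚ ℚ.≤ w k
0≤w k = ≤-trans 0≤1 (1≤w k)

v·e : ∀ a b → v a · e b ≡ ι 2 * (w a * w b) * (ι 2 * (ι b - ι a) - 1ℚ)
v·e a b = solve 4 (λ x y i j →
    x :* (con (ι 4) :* j :* y) :+ (con (ι 2) :* i :+ con 1ℚ) :* x :* (:- (con (ι 2) :* y))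
      := con (ι 2) :* (x :* y) :* (con (ι 2) :* (j :- i) :- con 1ℚ))
  refl (w a) (w b) (ι a) (ι b)

<⇒0≤v·e : ∀ {s k} → s < k → 0ℚ ℚ.≤ v s · e k
<⇒0≤v·e {s} {k} s<k = subst (0ℚ ℚ.≤_) (sym (v·e s k)) (0≤* (0≤* (0≤ι 2) (0≤* (0≤w s) (0≤w k))) 0≤2x-1)
  where
  1≤x = <⇒1≤ι-ι s<k
  0≤2x-1 : 0ℚ ℚ.≤ ι 2 * (ι k - ι s) - 1ℚ
  0≤2x-1 = subst (0ℚ ℚ.≤_) (solve 1 (λ x → x :+ (x :- con 1ℚ) := con (ι 2) :* x :- con 1ℚ) refl (ι k - ι s))
    (0≤+ (≤-trans 0≤1 1≤x) (≤⇒0≤- 1≤x))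

<⇒v·e≤0 : ∀ {s k} → s < k → v k · e s ℚ.≤ 0ℚ
<⇒v·e≤0 {s} {k} s<k = subst (ℚ._≤ 0ℚ) (sym v·e≡-) (neg-antimono-≤ (0≤* (0≤* (0≤ι 2) (0≤* (0≤w k) (0≤w s))) 0≤2x+1))
  where
  v·e≡- : v k · e s ≡ - (ι 2 * (w k * w s) * (ι 2 * (ι k - ι s) + 1ℚ))
  v·e≡- = trans (v·e k s) (solve 4 (λ x y i j →
      con (ι 2) :* (x :* y) :* (con (ι 2) :* (i :- j) :- con 1ℚ)
        := :- (con (ι 2) :* (x :* y) :* (con (ι 2) :* (j :- i) :+ con 1ℚ)))
    refl (w k) (w s) (ι s) (ι k))
  0≤2x+1 : 0ℚ ℚ.≤ ι 2 * (ι k - ι s) + 1ℚ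
  0≤2x+1 = 0≤+ (0≤* (0≤ι 2) (≤-trans 0≤1 (<⇒1≤ι-ι s<k))) 0≤1

-v·e-diag : ∀ k → - (v k · e k) ≡ ι 2 * (w k * w k)
-v·e-diag k = trans (cong -_ (v·e k k))
  (solve 2 (λ x i → :- (con (ι 2) :* (x :* x) :* (con (ι 2) :* (i :- i) :- con 1ℚ)) := con (ι 2) :* (x :* x))
    refl (w k) (ι k))

Σ<-v·e-difference : ∀ k → Σ< k (λ s → v s · e k) - Σ< k (λ s → v k · e s) ≡ ι 8 * w k * Q k
Σ<-v·e-difference k = begin
  Σ< k (λ s → v s · e k) - Σ< k (λ s → v k · e s)    ≡⟨ Σ<-sub k _ _ ⟩
  Σ< k (λ s → v s · e k - v k · e s)                 ≡⟨ Σ<-cong k term ⟩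
  Σ< k (λ s → ι 8 * w k * ((ι k - ι s) * w s))       ≡⟨ sym (Σ<-*ˡ k (ι 8 * w k) _) ⟩
  ι 8 * w k * Q k                                    ∎
  where
  open ≡-Reasoning
  term : ∀ s → v s · e k - v k · e s ≡ ι 8 * w k * ((ι k - ι s) * w s)
  term s = trans (cong₂ _-_ (v·e s k) (v·e k s)) (solve 4 (λ x y i j →
      con (ι 2) :* (x :* y) :* (con (ι 2) :* (j :- i) :- con 1ℚ)
        :- con (ι 2) :* (y :* x) :* (con (ι 2) :* (i :- j) :- con 1ℚ)
      := con (ι 8) :* y :* ((j :- i) :* x))
    refl (w s) (w k) (ι s) (ι k))

Q-suc : ∀ k → Q (suc k) ≡ Q k + P k + w k
Q-suc k = begin
  (ι (suc k) - ι k) * w k + Σ< k (λ s → (ι (suc k) - ι s) * w s)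
    ≡⟨ cong₂ _+_ (solve 2 (λ i x → (con 1ℚ :+ i :- i) :* x := x) refl (ι k) (w k))
                 (Σ<-cong k (λ s → solve 3 (λ i j x → (con 1ℚ :+ i :- j) :* x := (i :- j) :* x :+ x) refl (ι k) (ι s) (w s))) ⟩
  w k + Σ< k (λ s → (ι k - ι s) * w s + w s)
    ≡⟨ cong (w k +_) (sym (Σ<-+ k _ w)) ⟩
  w k + (Q k + P k)
    ≡⟨ solve 3 (λ x q p → x :+ (q :+ p) := q :+ p :+ x) refl (w k) (Q k) (P k) ⟩
  Q k + P k + w k ∎
  where open ≡-Reasoning

P≤w×8Q+1≤w : ∀ k → P k ℚ.≤ w k × ι 8 * Q k + 1ℚ ℚ.≤ w k
P≤w×8Q+1≤w zero    = 0≤1 , ≤-refl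
P≤w×8Q+1≤w (suc k) with P≤w×8Q+1≤w k
... | P≤w , 8Q+1≤w = P-step , Q-step
  where
  open ≤-Reasoning
  P-step : w k + P k ℚ.≤ ι 17 * w k
  P-step = begin
    w k + P k                  ≤⟨ +-monoʳ-≤ (w k) P≤w ⟩
    w k + w k                  ≤⟨ p≤p+q (w k + w k) (0≤* (0≤ι 15) (0≤w k)) ⟩
    w k + w k + ι 15 * w k     ≡⟨ solve 1 (λ x → x :+ x :+ con (ι 15) :* x := con (ι 17) :* x) refl (w k) ⟩
    ι 17 * w k                 ∎
  Q-step : ι 8 * Q (suc k) + 1ℚ ℚ.≤ ι 17 * w k
  Q-step = begin
    ι 8 * Q (suc k) + 1ℚ
      ≡⟨ cong (λ x → ι 8 * x + 1ℚ) (Q-suc k) ⟩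
    ι 8 * (Q k + P k + w k) + 1ℚ
      ≡⟨ solve 3 (λ q p x → con (ι 8) :* (q :+ p :+ x) :+ con 1ℚ := (con (ι 8) :* q :+ con 1ℚ) :+ con (ι 8) :* p :+ con (ι 8) :* x)
           refl (Q k) (P k) (w k) ⟩
    (ι 8 * Q k + 1ℚ) + ι 8 * P k + ι 8 * w k
      ≤⟨ +-monoˡ-≤ (ι 8 * w k) (+-mono-≤ 8Q+1≤w (*-monoˡ-≤-nonNeg (ι 8) {{nonNegative (0≤ι 8)}} P≤w)) ⟩
    w k + ι 8 * w k + ι 8 * w k
      ≡⟨ solve 1 (λ x → x :+ con (ι 8) :* x :+ con (ι 8) :* x := con (ι 17) :* x) refl (w k) ⟩
    ι 17 * w k ∎

8wQ+1<2ww : ∀ k → ι 8 * w k * Q k + 1ℚ ℚ.< ι 2 * (w k * w k)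
8wQ+1<2ww k = begin-strict
  ι 8 * w k * Q k + 1ℚ      ≤⟨ +-monoʳ-≤ (ι 8 * w k * Q k) (1≤w k) ⟩
  ι 8 * w k * Q k + w k     ≡⟨ solve 2 (λ x q → con (ι 8) :* x :* q :+ x := x :* (con (ι 8) :* q :+ con 1ℚ)) refl (w k) (Q k) ⟩
  w k * (ι 8 * Q k + 1ℚ)    ≤⟨ *-monoˡ-≤-nonNeg (w k) {{nonNegative (0≤w k)}} (proj₂ (P≤w×8Q+1≤w k)) ⟩
  w k * w k                 <⟨ p<p+q (w k * w k) 0<w² ⟩
  w k * w k + w k * w k     ≡⟨ solve 1 (λ x → x :* x :+ x :* x := con (ι 2) :* (x :* x)) refl (w k) ⟩
  ι 2 * (w k * w k)         ∎
  where
  open ≤-Reasoning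
  0<w : 0ℚ ℚ.< w k
  0<w = <-≤-trans (positive⁻¹ 1ℚ) (1≤w k)
  0<w² : 0ℚ ℚ.< w k * w k
  0<w² = positive⁻¹ (w k * w k) {{pos*pos⇒pos (w k) {{positive 0<w}} (w k) {{positive 0<w}}}}

origin : ℕ → ℚ²
origin n = Σ< n (proj₁ ∘ e) , 0ℚ

sink : ℕ → ℕ → ℚ
sink n k = v k · origin n - Σ< k (λ s → v k · e s) + 1ℚ

0≤e₁ : ∀ s → 0ℚ ℚ.≤ proj₁ (e s)
0≤e₁ s = 0≤* (0≤* (0≤ι 4) (0≤ι s)) (0≤w s)

e₂≤0 : ∀ s → proj₂ (e s) ℚ.≤ 0ℚ
e₂≤0 s = neg-antimono-≤ (0≤* (0≤ι 2) (0≤w s))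

0≤v : ∀ s → 0ℚ ℚ.≤ proj₁ (v s) × 0ℚ ℚ.≤ proj₂ (v s)
0≤v s = 0≤w s , 0≤* (0≤+ (0≤* (0≤ι 2) (0≤ι s)) 0≤1) (0≤w s)

0≤v·p : ∀ {p} → 0ℚ ℚ.≤ proj₁ p → 0ℚ ℚ.≤ proj₂ p → ∀ s → 0ℚ ℚ.≤ v s · p
0≤v·p 0≤p₁ 0≤p₂ s = 0≤+ (0≤* (proj₁ (0≤v s)) 0≤p₁) (0≤* (proj₂ (0≤v s)) 0≤p₂)

0≤sink : ∀ n k → 0ℚ ℚ.≤ sink n k
0≤sink n k = 0≤+ (0≤+ (0≤v·p 0≤Λ ≤-refl k) (neg-antimono-≤ (Σ<-nonPos {k} <⇒v·e≤0))) 0≤1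
  where
  0≤Λ : 0ℚ ℚ.≤ Σ< n (proj₁ ∘ e)
  0≤Λ = Σ<-nonNeg {n} (λ {s} _ → 0≤e₁ s)

module _ (n : ℕ) where
  open Layered v e (sink n)

  v·point : ∀ k S → v k · point (origin n) k S ≡ v k · origin n - Σ∈ k S (λ s → v k · e s)
  v·point k = point-additive (v k ·_) (·-⊖ (v k)) (origin n) k

  v·point<sink : ∀ k S → v k · point (origin n) k S ℚ.< sink n k
  v·point<sink k S = begin-strict
    v k · point (origin n) k S                          ≡⟨ v·point k S ⟩
    v k · origin n - Σ∈ k S (λ s → v k · e s)           ≤⟨ +-monoʳ-≤ (v k · origin n) (neg-antimono-≤ (Σ<≤Σ∈ <⇒v·e≤0 S)) ⟩
    v k · origin n - Σ< k (λ s → v k · e s)             <⟨ p<p+q _ (positive⁻¹ 1ℚ) ⟩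
    sink n k                                            ∎
    where open ≤-Reasoning

  sink+W<v·point⊖e : ∀ k S → sink n k + Σ< k (λ s → v s · e k) ℚ.< v k · (point (origin n) k S ⊖ e k)
  sink+W<v·point⊖e k S = begin-strict
    sink n k + W
      ≡⟨ solve 3 (λ a b x → a :- b :+ con 1ℚ :+ x := a :+ (x :- b :+ con 1ℚ)) refl (v k · o) B W ⟩
    v k · o + (W - B + 1ℚ)
      ≡⟨ cong (λ x → v k · o + (x + 1ℚ)) (Σ<-v·e-difference k) ⟩
    v k · o + (ι 8 * w k * Q k + 1ℚ)
      <⟨ +-monoʳ-< (v k · o) (8wQ+1<2ww k) ⟩
    v k · o + ι 2 * (w k * w k)
      ≡⟨ cong (v k · o +_) (sym (-v·e-diag k)) ⟩
    v k · o - v k · e k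
      ≤⟨ +-monoˡ-≤ (- (v k · e k)) v·o≤v·point ⟩
    v k · point o k S - v k · e k
      ≡⟨ sym (·-⊖ (v k) (point o k S) (e k)) ⟩
    v k · (point o k S ⊖ e k) ∎
    where
    open ≤-Reasoning
    o = origin n
    B = Σ< k (λ s → v k · e s)
    W = Σ< k (λ s → v s · e k)
    v·o≤v·point : v k · o ℚ.≤ v k · point o k S
    v·o≤v·point = subst (v k · o ℚ.≤_) (sym (v·point k S))
      (p≤p+q (v k · o) (neg-antimono-≤ (Σ∈-nonPos <⇒v·e≤0 S)))

  0≤point : ∀ S → 0ℚ ℚ.≤ proj₁ (point (origin n) n S) × 0ℚ ℚ.≤ proj₂ (point (origin n) n S)
  0≤point S =
    subst (0ℚ ℚ.≤_) (sym (point-additive proj₁ (λ _ _ → refl) (origin n) n S)) (≤⇒0≤- (Σ∈≤Σ< (λ {s} _ → 0≤e₁ s) S)) ,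
    subst (0ℚ ℚ.≤_) (sym (point-additive proj₂ (λ _ _ → refl) (origin n) n S)) (≤⇒0≤- (Σ∈-nonPos (λ {s} _ → e₂≤0 s) S))

theorem1 : (n : ℕ) → 1 ≤ n →
    Σ (ParamNet n) λ N → SSM N ×
      ((S : Subset n) → ∃[ l ] ∃[ m ] (Admissible N l m × UniqueMinCut N S l m))
theorem1 n _ = net n , net-SSM n 0≤v , λ S →
    proj₁ (q S) , proj₂ (q S) ,
    net-admissible <⇒0≤v·e n (q S) (0≤v·p (proj₁ (0≤point n S)) (proj₂ (0≤point n S))) (0≤sink n) ,
    point-unique <⇒0≤v·e (origin n) (v·point<sink n) (sink+W<v·point⊖e n) n S
  where
  open Layered v e (sink n)
  q : Subset n → ℚ²
  q = point (origin n) n
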